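{- Let $G_1=(V_1,E_1)$ and $G_2=(V_2,E_2)$ be graphs with disjoint vertex sets and let $v\in V_1$. Then $f(G_1\bullet_v G_2)\leq f(G_1)+f(G_2)$ for each $f\in\{\mathrm{thin},\mathrm{pthin},\mathrm{compthin},\mathrm{comppthin}\}$, and $f(G_1\bullet_v G_2)\leq f'(G_1)+f(G_2)-1$ for each $(f,f')\in\{(\mathrm{thin},\mathrm{indthin}),(\mathrm{indthin},\mathrm{indthin}),(\mathrm{pthin},\mathrm{indpthin}),(\mathrm{indpthin},\mathrm{indpthin})\}$. Moreover, if $G_2$ is complete, then $f(G_1\bullet_v G_2)=f(G_1)$ for each $f\in\{\mathrm{thin},\mathrm{pthin},\mathrm{compthin},\mathrm{comppthin}\}$.
   Context: Graphs are finite, simple, undirected. The lexicographical product of $G_1$ and $G_2$ over $v\in V_1$, $G_1\bullet_v G_2$, is the graph obtained from $G_1$ by replacing $v$ by $G_2$: its vertex set is $V_2\cup (V_1\setminus\{v\})$, and $x,y$ are adjacent iff either $x,y\in V_1\setminus\{v\}$ and $xy\in E_1$, or $x,y\in V_2$ and $xy\in E_2$, or $x\in V_1\setminus\{v\}$, $y\in V_2$ and $xv\in E_1$. For a graph $G=(V,E)$, an ordering $v_1,\dots,v_n$ of $V$ and a partition of $V$ are consistent if for every $r<s<t$, whenever $v_r,v_s$ are in the same class and $v_tv_r\in E$, then $v_tv_s\in E$; strongly consistent if moreover for every $r<s<t$, whenever $v_s,v_t$ are in the same class and $v_tv_r\in E$, then $v_sv_r\in E$. $\mathrm{thin}(G)$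 (resp. $\mathrm{pthin}(G)$) is the minimum number of classes of a partition of $V$ consistent (resp. strongly consistent) with some ordering of $V$. $\mathrm{indthin}$, $\mathrm{indpthin}$ are defined likewise requiring each class to be an independent set, and $\mathrm{compthin}$, $\mathrm{comppthin}$ requiring each class to be a clique. -}

module Defs where

open import Data.Nat using (ℕ; suc; _+_; _<_)
open import Data.Fin using (Fin; toℕ; splitAt; punchIn)
open import Data.Fin.Permutation using (Permutation′; _⟨$⟩ʳ_)
open import Data.Bool using (Bool; true; false)
open import Data.Sum using (_⊎_; inj₁; inj₂)
open import Data.Product using (Σ; _×_; _,_)
open import Relation.Binary.PropositionalEquality using (_≡_; _≢_)
open import Relation.Nullary using (¬_)

record Graph (n : ℕ) : Set where
  field
    adj    : Fin n → Fin n → Bool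
    sym    : ∀ x y → adj x y ≡ adj y x
    irrefl : ∀ x → adj x x ≡ false
open Graph public

E : ∀ {n} → Graph n → Fin n → Fin n → Set
E G x y = adj G x y ≡ true

Complete : ∀ {n} → Graph n → Set
Complete {n} G = ∀ (x y : Fin n) → x ≢ y → E G x y

-- V1 = Fin (suc m), V2 = Fin k (disjoint copies by construction).
-- The vertex set V2 ∪ (V1 ∖ {v}) is encoded as Fin (k + m) via splitAt k:
-- inj₁ b  is the vertex b of G2,
-- inj₂ y  is the vertex punchIn v y of V1 ∖ {v} (punchIn v enumerates V1 ∖ {v}).

module _ {m k : ℕ} (G1 : Graph (suc m)) (v : Fin (suc m)) (G2 : Graph k) where
  lexAdjSum : Fin k ⊎ Fin m → Fin k ⊎ Fin m → Bool
  lexAdjSum (inj₁ a) (inj₁ b) = adj G2 a b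
  lexAdjSum (inj₁ a) (inj₂ y) = adj G1 v (punchIn v y)
  lexAdjSum (inj₂ x) (inj₁ b) = adj G1 (punchIn v x) v
  lexAdjSum (inj₂ x) (inj₂ y) = adj G1 (punchIn v x) (punchIn v y)

  private
    S' : ∀ p q → lexAdjSum p q ≡ lexAdjSum q p
    S' (inj₁ a) (inj₁ b) = sym G2 a b
    S' (inj₁ a) (inj₂ y) = sym G1 v (punchIn v y)
    S' (inj₂ x) (inj₁ b) = sym G1 (punchIn v x) v
    S' (inj₂ x) (inj₂ y) = sym G1 (punchIn v x) (punchIn v y)

    I' : ∀ p → lexAdjSum p p ≡ false
    I' (inj₁ a) = irrefl G2 a
    I' (inj₂ x) = irrefl G1 (punchIn v x)

  _•[_]_ : Graph (k + m)
  _•[_]_ = record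
    { adj    = λ x y → lexAdjSum (splitAt k x) (splitAt k y)
    ; sym    = λ x y → S' (splitAt k x) (splitAt k y)
    ; irrefl = λ x → I' (splitAt k x)
    }

-- An ordering of V = Fin n is a permutation σ; vertex x is at position σ x.
-- A partition into (at most) c classes is a map  cls : Fin n → Fin c
-- (allowing empty classes does not change the minimum number of classes).

module _ {n : ℕ} (G : Graph n) (σ : Permutation′ n) {c : ℕ} (cls : Fin n → Fin c) where
  _≺_ : Fin n → Fin n → Set
  x ≺ y = toℕ (σ ⟨$⟩ʳ x) < toℕ (σ ⟨$⟩ʳ y)

  Consistent : Set
  Consistent = ∀ r s t → r ≺ s → s ≺ t → cls r ≡ cls s → E G t r → E G t s

  StronglyConsistent : Set
  StronglyConsistent =
    Consistent × (∀ r s t → r ≺ s → s ≺ t → cls s ≡ cls t → E G t r → E G s r)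

Unrestricted : ∀ {n} → Graph n → ∀ {c} → (Fin n → Fin c) → Set
Unrestricted G cls = Data.Unit.⊤
  where import Data.Unit

Independent : ∀ {n} → Graph n → ∀ {c} → (Fin n → Fin c) → Set
Independent G cls = ∀ x y → cls x ≡ cls y → ¬ E G x y

Cliques : ∀ {n} → Graph n → ∀ {c} → (Fin n → Fin c) → Set
Cliques G cls = ∀ x y → cls x ≡ cls y → x ≢ y → E G x y

HasPart : (strong : Bool)
        → (R : ∀ {n} → Graph n → ∀ {c} → (Fin n → Fin c) → Set)
        → ∀ {n} → Graph n → ℕ → Set
HasPart false R {n} G c =
  Σ (Permutation′ n) λ σ → Σ (Fin n → Fin c) λ cls → R G cls × Consistent G σ cls
HasPart true  R {n} G c =
  Σ (Permutation′ n) λ σ → Σ (Fin n → Fin c) λ cls → R G cls × StronglyConsistent G σ cls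

IsMin : ∀ {n} → (Graph n → ℕ → Set) → Graph n → ℕ → Set
IsMin P G c = P G c × (∀ c′ → P G c′ → c Data.Nat.≤ c′)
  where import Data.Nat

IsThin IsPThin IsIndThin IsIndPThin IsCompThin IsCompPThin : ∀ {n} → Graph n → ℕ → Set
IsThin      = IsMin (HasPart false Unrestricted)
IsPThin     = IsMin (HasPart true  Unrestricted)
IsIndThin   = IsMin (HasPart false Independent)
IsIndPThin  = IsMin (HasPart true  Independent)
IsCompThin  = IsMin (HasPart false Cliques)
IsCompPThin = IsMin (HasPart true  Cliques)

module Submission where

-- One construction does all the work: order
-- H like G1 with v replaced by the block of G2, and map the classes of G1 ∖ {v}
-- and of G2 into one set of classes by injections g and h.  If a G1-class meets a
-- G2-class only when it is the class of v, and then its neighbours of v meet only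
-- G2-vertices adjacent to all of G2 (the glue condition), the partition of H is
-- (strongly) consistent and keeps clique/independence restrictions.  Choosing
--   * disjoint classes gives                        f(H) ≤ f(G1) + f(G2);
--   * independent G1-classes, the class of v absorbing the first G2-class,
--                                                   f(H) ≤ f′(G1) + f(G2) - 1;
--   * complete G2, all in the class of v, gives     f(H) ≤ f(G1);
-- and f(G1) ≤ f(H) because G1 is an induced subgraph of H.  Orderings are never
-- built by hand: consistency is proved for an order relation, and any relation
-- containing the order of an injective ℕ-valued key is realised by ranking.

open import Defs
open import Data.Nat using (ℕ; zero; suc; _+_; _*_; _≤_; _<_; z≤n; s≤s; _<?_)
open import Data.Nat.Properties
  using (<-irrefl; <-asym; <-trans; <-cmp; ≤-antisym; m≤n⇒m≤1+n; m≤m+n; +-comm; +-suc;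
         +-monoʳ-<; *-monoˡ-≤; +-cancelˡ-<; +-cancelˡ-≡; module ≤-Reasoning)
open import Data.Fin using (Fin; zero; suc; toℕ; fromℕ<; punchIn; punchOut; splitAt; join; _↑ˡ_; _↑ʳ_)
open import Data.Fin.Properties
  using (toℕ<n; toℕ-fromℕ<; toℕ-injective; any?; _≟_; injective⇒≤; punchOut-injective;
         punchIn-injective; punchInᵢ≢i; punchIn-punchOut; splitAt-join; join-splitAt;
         ↑ˡ-injective; ↑ʳ-injective)
open import Data.Fin.Permutation using (Permutation′; _⟨$⟩ʳ_; _⟨$⟩ˡ_; permutation; inverseˡ)
  renaming (id to identity)
open import Data.Bool using (Bool; true; false)
open import Data.Unit using (tt)
open import Data.Product using (Σ; ∃; _×_; _,_; proj₁; proj₂)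
open import Data.Sum using (_⊎_; inj₁; inj₂)
open import Data.Sum.Properties using (inj₂-injective)
open import Data.Empty using (⊥-elim)
open import Function using (_∘_; id)
open import Function.Definitions using (Injective)
open import Relation.Nullary using (¬_; Dec; yes; no)
open import Relation.Binary using (tri<; tri≈; tri>)
open import Relation.Binary.PropositionalEquality
  using (_≡_; _≢_; refl; cong; cong₂; trans; subst; subst₂; ≢-sym; module ≡-Reasoning)
  renaming (sym to ≡-sym)

count : ∀ {n} {P : Fin n → Set} → (∀ i → Dec (P i)) → ℕ
count {zero}  P? = 0
count {suc n} P? with P? zero
... | yes _ = suc (count (P? ∘ suc))
... | no  _ = count (P? ∘ suc)

count-mono : ∀ {n} {P Q : Fin n → Set} (P? : ∀ i → Dec (P i)) (Q? : ∀ i → Dec (Q i)) →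
             (∀ i → P i → Q i) → count P? ≤ count Q?
count-mono {zero}  P? Q? P⇒Q = z≤n
count-mono {suc n} P? Q? P⇒Q with P? zero | Q? zero
... | yes _ | yes _  = s≤s (count-mono (P? ∘ suc) (Q? ∘ suc) (P⇒Q ∘ suc))
... | yes p | no ¬q  = ⊥-elim (¬q (P⇒Q zero p))
... | no  _ | yes _  = m≤n⇒m≤1+n (count-mono (P? ∘ suc) (Q? ∘ suc) (P⇒Q ∘ suc))
... | no  _ | no  _  = count-mono (P? ∘ suc) (Q? ∘ suc) (P⇒Q ∘ suc)

count-strict : ∀ {n} {P Q : Fin n → Set} (P? : ∀ i → Dec (P i)) (Q? : ∀ i → Dec (Q i)) →
               (∀ i → P i → Q i) → ∀ j → ¬ P j → Q j → count P? < count Q?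
count-strict {suc n} P? Q? P⇒Q zero ¬pj qj with P? zero | Q? zero
... | yes p | _      = ⊥-elim (¬pj p)
... | no  _ | yes _  = s≤s (count-mono (P? ∘ suc) (Q? ∘ suc) (P⇒Q ∘ suc))
... | no  _ | no ¬q  = ⊥-elim (¬q qj)
count-strict {suc n} P? Q? P⇒Q (suc j) ¬pj qj with P? zero | Q? zero
... | yes _ | yes _  = s≤s (count-strict (P? ∘ suc) (Q? ∘ suc) (P⇒Q ∘ suc) j ¬pj qj)
... | yes p | no ¬q  = ⊥-elim (¬q (P⇒Q zero p))
... | no  _ | yes _  = m≤n⇒m≤1+n (count-strict (P? ∘ suc) (Q? ∘ suc) (P⇒Q ∘ suc) j ¬pj qj)
... | no  _ | no  _  = count-strict (P? ∘ suc) (Q? ∘ suc) (P⇒Q ∘ suc) j ¬pj qj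

count-all : ∀ {n} → count {n} (λ _ → yes tt) ≡ n
count-all {zero}  = refl
count-all {suc n} = cong suc count-all

count-< : ∀ {n} {P : Fin n → Set} (P? : ∀ i → Dec (P i)) (j : Fin n) → ¬ P j → count P? < n
count-< P? j ¬pj =
  subst (count P? <_) count-all (count-strict P? (λ _ → yes tt) (λ _ _ → tt) j ¬pj tt)

pos : ∀ {n} → Permutation′ n → Fin n → ℕ
pos σ x = toℕ (σ ⟨$⟩ʳ x)

Earlier : ∀ {n} → Permutation′ n → Fin n → Fin n → Set
Earlier σ x y = pos σ x < pos σ y

pos-injective : ∀ {n} (σ : Permutation′ n) → Injective _≡_ _≡_ (pos σ)
pos-injective σ {x} {y} eq = begin
  x                   ≡⟨ inverseˡ σ ⟨
  σ ⟨$⟩ˡ (σ ⟨$⟩ʳ x)   ≡⟨ cong (σ ⟨$⟩ˡ_) (toℕ-injective eq) ⟩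
  σ ⟨$⟩ˡ (σ ⟨$⟩ʳ y)   ≡⟨ inverseˡ σ ⟩
  y                   ∎
  where open ≡-Reasoning

earlier⇒≢ : ∀ {n} (σ : Permutation′ n) {x y} → Earlier σ x y → x ≢ y
earlier⇒≢ σ x<y refl = <-irrefl refl x<y

injective⇒onto : ∀ {n} (f : Fin n → Fin n) → Injective _≡_ _≡_ f → ∀ y → ∃ λ x → f x ≡ y
injective⇒onto {suc n} f f-injective y with any? (λ x → f x ≟ y)
... | yes hit = hit
... | no miss = ⊥-elim (<-irrefl refl (injective⇒≤ squeeze-injective))
  where
  avoids : ∀ x → y ≢ f x
  avoids x y≡fx = miss (x , ≡-sym y≡fx)

  squeeze : Fin (suc n) → Fin n
  squeeze x = punchOut (avoids x)

  squeeze-injective : Injective _≡_ _≡_ squeeze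
  squeeze-injective eq = f-injective (punchOut-injective (avoids _) (avoids _) eq)

-- Every injective ℕ-valued key is realised by an ordering: ranking each element
-- by the number of elements of smaller key is a permutation of Fin n whose order
-- is the order of the keys.
module _ {n : ℕ} (key : Fin n → ℕ) (key-injective : Injective _≡_ _≡_ key) where
  private
    rank : Fin n → ℕ
    rank x = count (λ y → key y <? key x)

    rank-mono : ∀ {x y} → key x < key y → rank x < rank y
    rank-mono {x} {y} kx<ky = count-strict (λ z → key z <? key x) (λ z → key z <? key y)
      (λ _ kz<kx → <-trans kz<kx kx<ky) x (<-irrefl refl) kx<ky

    rank-reflects : ∀ {x y} → rank x < rank y → key x < key y
    rank-reflects {x} {y} rx<ry with <-cmp (key x) (key y)
    ... | tri< kx<ky _ _ = kx<ky
    ... | tri≈ _ kx≡ky _ = ⊥-elim (<-irrefl (cong rank (key-injective kx≡ky)) rx<ry)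
    ... | tri> _ _ ky<kx = ⊥-elim (<-asym rx<ry (rank-mono ky<kx))

    rank-injective : ∀ {x y} → rank x ≡ rank y → x ≡ y
    rank-injective {x} {y} rx≡ry with <-cmp (key x) (key y)
    ... | tri< kx<ky _ _ = ⊥-elim (<-irrefl rx≡ry (rank-mono kx<ky))
    ... | tri≈ _ kx≡ky _ = key-injective kx≡ky
    ... | tri> _ _ ky<kx = ⊥-elim (<-irrefl (≡-sym rx≡ry) (rank-mono ky<kx))

    rankFin : Fin n → Fin n
    rankFin x = fromℕ< (count-< (λ y → key y <? key x) x (<-irrefl refl))

    toℕ-rankFin : ∀ x → toℕ (rankFin x) ≡ rank x
    toℕ-rankFin x = toℕ-fromℕ< _

    rankFin-injective : Injective _≡_ _≡_ rankFin
    rankFin-injective {x} {y} eq = rank-injective (begin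
      rank x           ≡⟨ toℕ-rankFin x ⟨
      toℕ (rankFin x)  ≡⟨ cong toℕ eq ⟩
      toℕ (rankFin y)  ≡⟨ toℕ-rankFin y ⟩
      rank y           ∎)
      where open ≡-Reasoning

    onto : ∀ y → ∃ λ x → rankFin x ≡ y
    onto = injective⇒onto rankFin rankFin-injective

  keyOrdering : Σ (Permutation′ n) λ σ → ∀ {x y} → Earlier σ x y → key x < key y
  keyOrdering =
    permutation rankFin (proj₁ ∘ onto) (proj₂ ∘ onto) (λ x → rankFin-injective (proj₂ (onto (rankFin x)))) ,
    λ {x} {y} x<y → rank-reflects (subst₂ _<_ (toℕ-rankFin x) (toℕ-rankFin y) x<y)

Restriction : Set₁
Restriction = ∀ {n} → Graph n → ∀ {c} → (Fin n → Fin c) → Set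

module _ {n : ℕ} (G : Graph n) (_⊏_ : Fin n → Fin n → Set) {c : ℕ} (cls : Fin n → Fin c) where
  ForwardConsistent : Set
  ForwardConsistent = ∀ r s t → r ⊏ s → s ⊏ t → cls r ≡ cls s → E G t r → E G t s

  BackwardConsistent : Set
  BackwardConsistent = ∀ r s t → r ⊏ s → s ⊏ t → cls s ≡ cls t → E G t r → E G s r

-- Consistency (false) or strong consistency (true); with _⊏_ = Earlier σ these
-- are definitionally Defs.Consistent and Defs.StronglyConsistent.
ConsistentWrt : Bool → ∀ {n} → Graph n → (Fin n → Fin n → Set) → ∀ {c} → (Fin n → Fin c) → Set
ConsistentWrt false G _⊏_ cls = ForwardConsistent G _⊏_ cls
ConsistentWrt true  G _⊏_ cls = ForwardConsistent G _⊏_ cls × BackwardConsistent G _⊏_ cls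

consistentWrt-⊆ : ∀ s {n} {G : Graph n} {_⊏_ _⊏′_ : Fin n → Fin n → Set} {c} {cls : Fin n → Fin c} →
                  (∀ {x y} → x ⊏′ y → x ⊏ y) → ConsistentWrt s G _⊏_ cls → ConsistentWrt s G _⊏′_ cls
consistentWrt-⊆ false ⊆ fwd r s t r⊏s s⊏t = fwd r s t (⊆ r⊏s) (⊆ s⊏t)
consistentWrt-⊆ true ⊆ (fwd , bwd) =
  (λ r s t r⊏s s⊏t → fwd r s t (⊆ r⊏s) (⊆ s⊏t)) , (λ r s t r⊏s s⊏t → bwd r s t (⊆ r⊏s) (⊆ s⊏t))

record Part (s : Bool) (R : Restriction) {n} (G : Graph n) (c : ℕ) : Set where
  constructor part
  field
    order      : Permutation′ n
    classes    : Fin n → Fin c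
    restricted : R G classes
    consistent : ConsistentWrt s G (Earlier order) classes
open Part

fromHasPart : ∀ s {R : Restriction} {n} {G : Graph n} {c} → HasPart s R G c → Part s R G c
fromHasPart false (σ , cls , r , con) = part σ cls r con
fromHasPart true  (σ , cls , r , con) = part σ cls r con

toHasPart : ∀ s {R : Restriction} {n} {G : Graph n} {c} → Part s R G c → HasPart s R G c
toHasPart false (part σ cls r con) = σ , cls , r , con
toHasPart true  (part σ cls r con) = σ , cls , r , con

fromKey : ∀ s {R : Restriction} {n} {G : Graph n} {c} {_⊏_ : Fin n → Fin n → Set}
          (key : Fin n → ℕ) → Injective _≡_ _≡_ key → (∀ {x y} → key x < key y → x ⊏ y) →
          (cls : Fin n → Fin c) → R G cls → ConsistentWrt s G _⊏_ cls → Part s R G c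
fromKey s key key-injective key⊆ cls r con =
  let (σ , σ⊆key) = keyOrdering key key-injective
  in  part σ cls r (consistentWrt-⊆ s (key⊆ ∘ σ⊆key) con)

single : ∀ {n} → Fin n → Fin 1
single _ = zero

complete-consistent : ∀ s {n} {G : Graph n} → Complete G → (σ : Permutation′ n) →
                      ConsistentWrt s G (Earlier σ) single
complete-consistent false complete σ r s t _ s<t _ _ = complete t s (≢-sym (earlier⇒≢ σ s<t))
complete-consistent true  complete σ =
  (λ r s t _ s<t _ _ → complete t s (≢-sym (earlier⇒≢ σ s<t))) ,
  (λ r s t r<s _ _ _ → complete s r (≢-sym (earlier⇒≢ σ r<s)))

complete-cliques : ∀ {n} {G : Graph n} → Complete G → Cliques G single
complete-cliques complete x y _ = complete x y

record Embedding {n n′} (G : Graph n) (G′ : Graph n′) : Set where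
  field
    map       : Fin n → Fin n′
    injective : Injective _≡_ _≡_ map
    adj-map   : ∀ x y → adj G′ (map x) (map y) ≡ adj G x y

PullbackClosed : Restriction → Set
PullbackClosed R = ∀ {n n′} {G : Graph n} {G′ : Graph n′} (e : Embedding G G′) {c}
                   (cls : Fin n′ → Fin c) → R G′ cls → R G (cls ∘ Embedding.map e)

unrestricted-pullback : PullbackClosed Unrestricted
unrestricted-pullback _ _ _ = tt

module _ {n n′} {G : Graph n} {G′ : Graph n′} (e : Embedding G G′) where
  open Embedding e

  edge← : ∀ {x y} → E G′ (map x) (map y) → E G x y
  edge← {x} {y} xy = trans (≡-sym (adj-map x y)) xy

  edge→ : ∀ {x y} → E G x y → E G′ (map x) (map y)
  edge→ {x} {y} xy = trans (adj-map x y) xy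

  consistent-pullback : ∀ s {_⊏_ : Fin n′ → Fin n′ → Set} {c} {cls : Fin n′ → Fin c} →
                        ConsistentWrt s G′ _⊏_ cls →
                        ConsistentWrt s G (λ x y → map x ⊏ map y) (cls ∘ map)
  consistent-pullback false fwd r s t r⊏s s⊏t same tr =
    edge← (fwd (map r) (map s) (map t) r⊏s s⊏t same (edge→ tr))
  consistent-pullback true (fwd , bwd) =
    (λ r s t r⊏s s⊏t same tr → edge← (fwd (map r) (map s) (map t) r⊏s s⊏t same (edge→ tr))) ,
    (λ r s t r⊏s s⊏t same tr → edge← (bwd (map r) (map s) (map t) r⊏s s⊏t same (edge→ tr)))

  induced-part : ∀ s {R : Restriction} {c} → PullbackClosed R → Part s R G′ c → Part s R G c
  induced-part s closed (part σ cls r con) =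
    fromKey s (pos σ ∘ map) (injective ∘ pos-injective σ) id
      (cls ∘ map) (closed e cls r) (consistent-pullback s con)

cliques-pullback : PullbackClosed Cliques
cliques-pullback e cls clique x y same x≢y =
  edge← e (clique (map x) (map y) same (x≢y ∘ injective))
  where open Embedding e

module _ (K : ℕ) where
  code : ℕ → ℕ → ℕ
  code a b = a * K + b

  code-mono : ∀ {a a′ b b′} → a < a′ → b < K → code a b < code a′ b′
  code-mono {a} {a′} {b} {b′} a<a′ b<K = begin-strict
    a * K + b   <⟨ +-monoʳ-< (a * K) b<K ⟩
    a * K + K   ≡⟨ +-comm (a * K) K ⟩
    suc a * K   ≤⟨ *-monoˡ-≤ K a<a′ ⟩
    a′ * K      ≤⟨ m≤m+n (a′ * K) b′ ⟩
    a′ * K + b′ ∎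
    where open ≤-Reasoning

  code-reflects : ∀ {a a′ b b′} → b < K → b′ < K → code a b < code a′ b′ → a < a′ ⊎ (a ≡ a′ × b < b′)
  code-reflects {a} {a′} {b} {b′} b<K b′<K ab<a′b′ with <-cmp a a′
  ... | tri< a<a′ _ _ = inj₁ a<a′
  ... | tri≈ _ refl _ = inj₂ (refl , +-cancelˡ-< (a * K) b b′ ab<a′b′)
  ... | tri> _ _ a′<a = ⊥-elim (<-asym ab<a′b′ (code-mono a′<a b′<K))

  code-injective : ∀ {a a′ b b′} → b < K → b′ < K → code a b ≡ code a′ b′ → a ≡ a′ × b ≡ b′
  code-injective {a} {a′} {b} {b′} b<K b′<K ab≡a′b′ with <-cmp a a′
  ... | tri< a<a′ _ _ = ⊥-elim (<-irrefl ab≡a′b′ (code-mono a<a′ b<K))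
  ... | tri≈ _ refl _ = refl , +-cancelˡ-≡ (a * K) b b′ ab≡a′b′
  ... | tri> _ _ a′<a = ⊥-elim (<-irrefl (≡-sym ab≡a′b′) (code-mono a′<a b′<K))

join-injective : ∀ b c → Injective _≡_ _≡_ (join b c)
join-injective b c {p} {q} eq = begin
  p                     ≡⟨ splitAt-join b c p ⟨
  splitAt b (join b c p) ≡⟨ cong (splitAt b) eq ⟩
  splitAt b (join b c q) ≡⟨ splitAt-join b c q ⟩
  q                     ∎
  where open ≡-Reasoning

↑ˡ≢↑ʳ : ∀ {b c} {i : Fin b} {j : Fin c} → i ↑ˡ c ≢ b ↑ʳ j
↑ˡ≢↑ʳ {b} {c} {i} {j} eq with join-injective b c {inj₁ i} {inj₂ j} eq
... | ()

mergeAt : ∀ {b c} → Fin b → Fin (suc c) → Fin (b + c)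
mergeAt {b} {c} u zero    = u ↑ˡ c
mergeAt {b} {c} u (suc j) = b ↑ʳ j

mergeAt-injective : ∀ {b c} (u : Fin b) → Injective _≡_ _≡_ (mergeAt {b} {c} u)
mergeAt-injective u {zero}  {zero}  _  = refl
mergeAt-injective u {zero}  {suc j} eq = ⊥-elim (↑ˡ≢↑ʳ eq)
mergeAt-injective u {suc i} {zero}  eq = ⊥-elim (↑ˡ≢↑ʳ (≡-sym eq))
mergeAt-injective {b} u {suc i} {suc j} eq = cong suc (↑ʳ-injective b i j eq)

constant-injective : ∀ {C} (u : Fin C) → Injective _≡_ _≡_ (λ (_ : Fin 1) → u)
constant-injective u {zero} {zero} _ = refl

module Substitution {m k : ℕ} (G1 : Graph (suc m)) (v : Fin (suc m)) (G2 : Graph (suc k)) where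
  K : ℕ
  K = suc k

  H : Graph (K + m)
  H = G1 •[ v ] G2

  Vertex : Set
  Vertex = Fin K ⊎ Fin m

  split : Fin (K + m) → Vertex
  split = splitAt K

  split-injective : Injective _≡_ _≡_ split
  split-injective {x} {y} eq = begin
    x                  ≡⟨ join-splitAt K m x ⟨
    join K m (split x) ≡⟨ cong (join K m) eq ⟩
    join K m (split y) ≡⟨ join-splitAt K m y ⟩
    y                  ∎
    where open ≡-Reasoning

  pI : Fin m → Fin (suc m)
  pI = punchIn v

  -- adjacency of H on Vertex: E H x y is definitionally split x ~ split y
  _~_ : Vertex → Vertex → Set
  p ~ q = lexAdjSum G1 v G2 p q ≡ true

  -- H is ordered like G1, with v replaced by the block of G2 ordered by σ2; the
  -- order is realised by the lexicographic key (position of the G1-vertex,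
  -- position inside the block).
  module Order (σ1 : Permutation′ (suc m)) (σ2 : Permutation′ K) where
    _⊏_ : Vertex → Vertex → Set
    inj₁ b ⊏ inj₁ b′ = Earlier σ2 b b′
    inj₁ b ⊏ inj₂ y  = Earlier σ1 v (pI y)
    inj₂ y ⊏ inj₁ b  = Earlier σ1 (pI y) v
    inj₂ y ⊏ inj₂ y′ = Earlier σ1 (pI y) (pI y′)

    key : Vertex → ℕ
    key (inj₁ b) = code K (pos σ1 v) (pos σ2 b)
    key (inj₂ y) = code K (pos σ1 (pI y)) 0

    private
      0<K : 0 < K
      0<K = s≤s z≤n

      pI≢v : ∀ {y} → pos σ1 (pI y) ≢ pos σ1 v
      pI≢v {y} = punchInᵢ≢i v y ∘ pos-injective σ1

    key-reflects : ∀ {p q} → key p < key q → p ⊏ q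
    key-reflects {inj₁ b} {inj₁ b′} lt with code-reflects K {pos σ1 v} {pos σ1 v} (toℕ<n _) (toℕ<n _) lt
    ... | inj₁ v<v = ⊥-elim (<-irrefl refl v<v)
    ... | inj₂ (_ , b<b′) = b<b′
    key-reflects {inj₁ b} {inj₂ y} lt with code-reflects K (toℕ<n _) 0<K lt
    ... | inj₁ v<y = v<y
    ... | inj₂ (_ , ())
    key-reflects {inj₂ y} {inj₁ b} lt with code-reflects K 0<K (toℕ<n _) lt
    ... | inj₁ y<v = y<v
    ... | inj₂ (y≡v , _) = ⊥-elim (pI≢v y≡v)
    key-reflects {inj₂ y} {inj₂ y′} lt with code-reflects K 0<K 0<K lt
    ... | inj₁ y<y′ = y<y′
    ... | inj₂ (_ , ())

    key-injective : Injective _≡_ _≡_ key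
    key-injective {inj₁ b} {inj₁ b′} eq =
      cong inj₁ (pos-injective σ2 (proj₂ (code-injective K {pos σ1 v} {pos σ1 v} (toℕ<n _) (toℕ<n _) eq)))
    key-injective {inj₁ b} {inj₂ y} eq =
      ⊥-elim (pI≢v (≡-sym (proj₁ (code-injective K (toℕ<n _) 0<K eq))))
    key-injective {inj₂ y} {inj₁ b} eq =
      ⊥-elim (pI≢v (proj₁ (code-injective K 0<K (toℕ<n _) eq)))
    key-injective {inj₂ y} {inj₂ y′} eq =
      cong inj₂ (punchIn-injective v y y′ (pos-injective σ1 (proj₁ (code-injective K 0<K 0<K eq))))

  module Classes {c1 c2 C : ℕ} (cls1 : Fin (suc m) → Fin c1) (cls2 : Fin K → Fin c2)
                 (g : Fin c1 → Fin C) (h : Fin c2 → Fin C) where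
    class : Vertex → Fin C
    class (inj₁ b) = h (cls2 b)
    class (inj₂ y) = g (cls1 (pI y))

    glued : Fin (K + m) → Fin C
    glued = class ∘ split

    Glue : Set
    Glue = ∀ y b → g (cls1 (pI y)) ≡ h (cls2 b) →
           cls1 (pI y) ≡ cls1 v × (E G1 (pI y) v → ∀ b′ → b′ ≢ b → E G2 b′ b)

    glued-independent : Injective _≡_ _≡_ g → Injective _≡_ _≡_ h → Glue →
                        Independent G1 cls1 → Independent G2 cls2 → Independent H glued
    glued-independent g-injective h-injective glue ind1 ind2 x x′ = go (split x) (split x′)
      where
      go : ∀ p q → class p ≡ class q → ¬ p ~ q
      go (inj₁ b) (inj₁ b′) same = ind2 b b′ (h-injective same)
      go (inj₁ b) (inj₂ y)  same vy =
        ind1 (pI y) v (proj₁ (glue y b (≡-sym same))) (trans (sym G1 (pI y) v) vy)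
      go (inj₂ y) (inj₁ b)  same = ind1 (pI y) v (proj₁ (glue y b same))
      go (inj₂ y) (inj₂ y′) same = ind1 (pI y) (pI y′) (g-injective same)

    glued-cliques : Injective _≡_ _≡_ g → Injective _≡_ _≡_ h → Glue →
                    Cliques G1 cls1 → Cliques G2 cls2 → Cliques H glued
    glued-cliques g-injective h-injective glue cl1 cl2 x x′ same x≢x′ =
      go (split x) (split x′) same (x≢x′ ∘ split-injective)
      where
      toward-v : ∀ y b → g (cls1 (pI y)) ≡ h (cls2 b) → E G1 (pI y) v
      toward-v y b same = cl1 (pI y) v (proj₁ (glue y b same)) (punchInᵢ≢i v y)

      go : ∀ p q → class p ≡ class q → p ≢ q → p ~ q
      go (inj₁ b) (inj₁ b′) same b≢b′ = cl2 b b′ (h-injective same) (b≢b′ ∘ cong inj₁)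
      go (inj₁ b) (inj₂ y)  same _    = trans (sym G1 v (pI y)) (toward-v y b (≡-sym same))
      go (inj₂ y) (inj₁ b)  same _    = toward-v y b same
      go (inj₂ y) (inj₂ y′) same y≢y′ =
        cl1 (pI y) (pI y′) (g-injective same) (y≢y′ ∘ cong inj₂ ∘ punchIn-injective v y y′)

  module Consistency (σ1 : Permutation′ (suc m)) (σ2 : Permutation′ K)
                     {c1 c2 C : ℕ} (cls1 : Fin (suc m) → Fin c1) (cls2 : Fin K → Fin c2)
                     (g : Fin c1 → Fin C) (h : Fin c2 → Fin C)
                     (g-injective : Injective _≡_ _≡_ g) (h-injective : Injective _≡_ _≡_ h)
                     (glue : Classes.Glue cls1 cls2 g h) where
    open Order σ1 σ2
    open Classes cls1 cls2 g h

    forward : ForwardConsistent G1 (Earlier σ1) cls1 → ForwardConsistent G2 (Earlier σ2) cls2 →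
              ∀ p q u → p ⊏ q → q ⊏ u → class p ≡ class q → u ~ p → u ~ q
    forward C1 C2 (inj₁ r) (inj₁ s) (inj₁ t) r<s s<t same tr = C2 r s t r<s s<t (h-injective same) tr
    forward C1 C2 (inj₁ r) (inj₁ s) (inj₂ t) r<s s<t same tr = tr
    forward C1 C2 (inj₁ r) (inj₂ s) (inj₁ t) r<s s<t same tr = ⊥-elim (<-asym r<s s<t)
    forward C1 C2 (inj₁ r) (inj₂ s) (inj₂ t) r<s s<t same tr =
      C1 v (pI s) (pI t) r<s s<t (≡-sym (proj₁ (glue s r (≡-sym same)))) tr
    forward C1 C2 (inj₂ r) (inj₁ s) (inj₁ t) r<s s<t same tr =
      proj₂ (glue r s same) (trans (sym G1 (pI r) v) tr) t (≢-sym (earlier⇒≢ σ2 s<t))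
    forward C1 C2 (inj₂ r) (inj₁ s) (inj₂ t) r<s s<t same tr =
      C1 (pI r) v (pI t) r<s s<t (proj₁ (glue r s same)) tr
    forward C1 C2 (inj₂ r) (inj₂ s) (inj₁ t) r<s s<t same tr = C1 (pI r) (pI s) v r<s s<t (g-injective same) tr
    forward C1 C2 (inj₂ r) (inj₂ s) (inj₂ t) r<s s<t same tr =
      C1 (pI r) (pI s) (pI t) r<s s<t (g-injective same) tr

    backward : BackwardConsistent G1 (Earlier σ1) cls1 → BackwardConsistent G2 (Earlier σ2) cls2 →
               ∀ p q u → p ⊏ q → q ⊏ u → class q ≡ class u → u ~ p → q ~ p
    backward B1 B2 (inj₁ r) (inj₁ s) (inj₁ t) r<s s<t same tr = B2 r s t r<s s<t (h-injective same) tr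
    backward B1 B2 (inj₁ r) (inj₁ s) (inj₂ t) r<s s<t same tr =
      trans (sym G2 s r) (proj₂ (glue t s (≡-sym same)) tr r (earlier⇒≢ σ2 r<s))
    backward B1 B2 (inj₁ r) (inj₂ s) (inj₁ t) r<s s<t same tr = ⊥-elim (<-asym r<s s<t)
    backward B1 B2 (inj₁ r) (inj₂ s) (inj₂ t) r<s s<t same tr = B1 v (pI s) (pI t) r<s s<t (g-injective same) tr
    backward B1 B2 (inj₂ r) (inj₁ s) (inj₁ t) r<s s<t same tr = tr
    backward B1 B2 (inj₂ r) (inj₁ s) (inj₂ t) r<s s<t same tr =
      B1 (pI r) v (pI t) r<s s<t (≡-sym (proj₁ (glue t s (≡-sym same)))) tr
    backward B1 B2 (inj₂ r) (inj₂ s) (inj₁ t) r<s s<t same tr =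
      B1 (pI r) (pI s) v r<s s<t (proj₁ (glue s t same)) tr
    backward B1 B2 (inj₂ r) (inj₂ s) (inj₂ t) r<s s<t same tr =
      B1 (pI r) (pI s) (pI t) r<s s<t (g-injective same) tr

    glued-consistent : ∀ s → ConsistentWrt s G1 (Earlier σ1) cls1 → ConsistentWrt s G2 (Earlier σ2) cls2 →
                 ConsistentWrt s H (λ x y → split x ⊏ split y) glued
    glued-consistent false C1 C2 r s t = forward C1 C2 (split r) (split s) (split t)
    glued-consistent true (C1 , B1) (C2 , B2) =
      (λ r s t → forward C1 C2 (split r) (split s) (split t)) ,
      (λ r s t → backward B1 B2 (split r) (split s) (split t))

  GlueClosed : Restriction → Set
  GlueClosed R = ∀ {c1 c2 C} (cls1 : Fin (suc m) → Fin c1) (cls2 : Fin K → Fin c2)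
                   (g : Fin c1 → Fin C) (h : Fin c2 → Fin C) →
                 Injective _≡_ _≡_ g → Injective _≡_ _≡_ h → Classes.Glue cls1 cls2 g h →
                 R G1 cls1 → R G2 cls2 → R H (Classes.glued cls1 cls2 g h)

  unrestricted-closed : GlueClosed Unrestricted
  unrestricted-closed _ _ _ _ _ _ _ _ _ = tt

  independent-closed : GlueClosed Independent
  independent-closed = Classes.glued-independent

  cliques-closed : GlueClosed Cliques
  cliques-closed = Classes.glued-cliques

  gluedPart : ∀ s {R : Restriction} → GlueClosed R → ∀ {c1 c2 C} (P1 : Part s R G1 c1) (P2 : Part s R G2 c2)
              (g : Fin c1 → Fin C) (h : Fin c2 → Fin C) → Injective _≡_ _≡_ g → Injective _≡_ _≡_ h →
              Classes.Glue (classes P1) (classes P2) g h → Part s R H C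
  gluedPart s closed (part σ1 cls1 r1 con1) (part σ2 cls2 r2 con2) g h g-injective h-injective glue =
    fromKey s (key ∘ split) (split-injective ∘ key-injective) key-reflects
      (Classes.glued cls1 cls2 g h) (closed cls1 cls2 g h g-injective h-injective glue r1 r2)
      (Consistency.glued-consistent σ1 σ2 cls1 cls2 g h g-injective h-injective glue s con1 con2)
    where open Order σ1 σ2

  disjointPart : ∀ s {R : Restriction} → GlueClosed R → ∀ {b c} → Part s R G1 b → Part s R G2 c → Part s R H (b + c)
  disjointPart s closed {b} {c} P1 P2 =
    gluedPart s closed P1 P2 (_↑ˡ c) (b ↑ʳ_) (↑ˡ-injective c _ _) (↑ʳ-injective b _ _)
      (λ _ _ meet → ⊥-elim (↑ˡ≢↑ʳ meet))

  -- f(H) ≤ f′(G1) + f(G2) - 1: with independent classes in G1, the class of v can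
  -- absorb the first class of G2, as no vertex of that class is adjacent to v.
  mergedPart : ∀ s {R : Restriction} → GlueClosed R →
               (∀ {n} {G : Graph n} {c} {cls : Fin n → Fin c} → Independent G cls → R G cls) →
               ∀ {b c} → Part s Independent G1 b → Part s R G2 (suc c) → Part s R H (b + c)
  mergedPart s closed ind⇒R {b} {c} (part σ1 cls1 ind1 con1) P2 =
    gluedPart s closed (part σ1 cls1 (ind⇒R ind1) con1) P2 (_↑ˡ c) (mergeAt (cls1 v))
      (↑ˡ-injective c _ _) (mergeAt-injective (cls1 v)) glue
    where
    in-class-of-v : ∀ y j → cls1 (pI y) ↑ˡ c ≡ mergeAt (cls1 v) j → cls1 (pI y) ≡ cls1 v
    in-class-of-v y zero    meet = ↑ˡ-injective c _ _ meet
    in-class-of-v y (suc j) meet = ⊥-elim (↑ˡ≢↑ʳ meet)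

    glue : Classes.Glue cls1 (classes P2) (_↑ˡ c) (mergeAt (cls1 v))
    glue y b meet = same , λ yv → ⊥-elim (ind1 (pI y) v same yv)
      where same = in-class-of-v y (classes P2 b) meet

  completePart : Complete G2 → ∀ s {R : Restriction} → GlueClosed R → R G2 single → ∀ {b} → Part s R G1 b → Part s R H b
  completePart complete s closed r2 P1 =
    gluedPart s closed P1 (part identity single r2 (complete-consistent s complete identity))
      id (λ _ → classes P1 v) id (constant-injective (classes P1 v))
      (λ _ b same → same , λ _ b′ b′≢b → complete b′ b b′≢b)

  -- G1 is the induced subgraph of H on V1 ∖ {v} and one vertex of G2.
  restore : Fin (suc m) → Vertex
  restore u with v ≟ u
  ... | yes _   = inj₁ zero
  ... | no v≢u  = inj₂ (punchOut v≢u)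

  restore-adj : ∀ u u′ → lexAdjSum G1 v G2 (restore u) (restore u′) ≡ adj G1 u u′
  restore-adj u u′ with v ≟ u | v ≟ u′
  ... | yes refl | yes refl = trans (irrefl G2 zero) (≡-sym (irrefl G1 v))
  ... | yes refl | no v≢u′  = cong (adj G1 v) (punchIn-punchOut v≢u′)
  ... | no v≢u   | yes refl = cong (λ w → adj G1 w v) (punchIn-punchOut v≢u)
  ... | no v≢u   | no v≢u′  = cong₂ (adj G1) (punchIn-punchOut v≢u) (punchIn-punchOut v≢u′)

  restore-injective : Injective _≡_ _≡_ restore
  restore-injective {u} {u′} eq with v ≟ u | v ≟ u′
  restore-injective refl | yes refl | yes refl = refl
  restore-injective ()   | yes refl | no _
  restore-injective ()   | no _     | yes refl
  restore-injective eq   | no v≢u   | no v≢u′  = punchOut-injective v≢u v≢u′ (inj₂-injective eq)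

  G1↪H : Embedding G1 H
  G1↪H = record
    { map       = join K m ∘ restore
    ; injective = restore-injective ∘ join-injective K m
    ; adj-map   = λ u u′ → trans
        (cong₂ (lexAdjSum G1 v G2) (splitAt-join K m (restore u)) (splitAt-join K m (restore u′)))
        (restore-adj u u′)
    }

  sum-bound : ∀ s (R : Restriction) → GlueClosed R → ∀ a b c →
              IsMin (HasPart s R) H a → IsMin (HasPart s R) G1 b → IsMin (HasPart s R) G2 c → a ≤ b + c
  sum-bound s R closed a b c (_ , least) (P1 , _) (P2 , _) =
    least (b + c) (toHasPart s (disjointPart s closed (fromHasPart s P1) (fromHasPart s P2)))

  merged-bound : ∀ s (R : Restriction) → GlueClosed R →
                 (∀ {n} {G : Graph n} {c} {cls : Fin n → Fin c} → Independent G cls → R G cls) →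
                 ∀ a b c → IsMin (HasPart s R) H a → IsMin (HasPart s Independent) G1 b →
                 IsMin (HasPart s R) G2 c → a + 1 ≤ b + c
  merged-bound s R closed ind⇒R a b zero    _ _ (P2 , _) with () ← classes (fromHasPart s P2) zero
  merged-bound s R closed ind⇒R a b (suc c) (_ , least) (P1 , _) (P2 , _) =
    subst₂ _≤_ (+-comm 1 a) (≡-sym (+-suc b c))
      (s≤s (least (b + c) (toHasPart s (mergedPart s closed ind⇒R (fromHasPart s P1) (fromHasPart s P2)))))

  complete-bound : ∀ s (R : Restriction) → GlueClosed R → PullbackClosed R → (Complete G2 → R G2 single) →
                   Complete G2 → ∀ a b → IsMin (HasPart s R) H a → IsMin (HasPart s R) G1 b → a ≡ b
  complete-bound s R closed pulled r2 complete a b (PH , leastH) (P1 , least1) = ≤-antisym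
    (leastH b (toHasPart s (completePart complete s closed (r2 complete) (fromHasPart s P1))))
    (least1 a (toHasPart s (induced-part G1↪H s pulled (fromHasPart s PH))))

theorem4p14 :
    ∀ {m k : ℕ} (G1 : Graph (suc m)) (v : Fin (suc m)) (G2 : Graph (suc k)) →
    let H : Graph (suc k + m)
        H = G1 •[ v ] G2
        -- f(H) ≤ f(G1) + f(G2)
        Sub : (∀ {n} → Graph n → ℕ → Set) → Set
        Sub f = ∀ a b c → f H a → f G1 b → f G2 c → a ≤ b + c
        -- f(H) ≤ f'(G1) + f(G2) - 1
        Sub′ : (∀ {n} → Graph n → ℕ → Set) → (∀ {n} → Graph n → ℕ → Set) → Set
        Sub′ f f′ = ∀ a b c → f H a → f′ G1 b → f G2 c → a + 1 ≤ b + c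
        -- G2 complete ⇒ f(H) = f(G1)
        Eq : (∀ {n} → Graph n → ℕ → Set) → Set
        Eq f = Complete G2 → ∀ a b → f H a → f G1 b → a ≡ b
    in (Sub IsThin × Sub IsPThin × Sub IsCompThin × Sub IsCompPThin)
     × (Sub′ IsThin IsIndThin × Sub′ IsIndThin IsIndThin
        × Sub′ IsPThin IsIndPThin × Sub′ IsIndPThin IsIndPThin)
     × (Eq IsThin × Eq IsPThin × Eq IsCompThin × Eq IsCompPThin)
theorem4p14 G1 v G2 =
  ( sum-bound false Unrestricted unrestricted-closed , sum-bound true Unrestricted unrestricted-closed
  , sum-bound false Cliques cliques-closed           , sum-bound true Cliques cliques-closed )
  , ( merged-bound false Unrestricted unrestricted-closed (λ _ → tt)
    , merged-bound false Independent independent-closed id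
    , merged-bound true Unrestricted unrestricted-closed (λ _ → tt)
    , merged-bound true Independent independent-closed id )
  , ( complete-bound false Unrestricted unrestricted-closed unrestricted-pullback (λ _ → tt)
    , complete-bound true Unrestricted unrestricted-closed unrestricted-pullback (λ _ → tt)
    , complete-bound false Cliques cliques-closed cliques-pullback (complete-cliques {G = G2})
    , complete-bound true Cliques cliques-closed cliques-pullback (complete-cliques {G = G2}) )
  where open Substitution G1 v G2
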